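{- Let $D$ be a loose multipartite tournament in which every partite set has at most two vertices. Then $C_{1,2}(D)$ is an interval graph.
   Context: All graphs and digraphs are finite and simple. For a digraph $D$, $d_D(x,y)$ is the length of a shortest directed path from $x$ to $y$. The $(1,2)$-step competition graph $C_{1,2}(D)$ is the graph on $V(D)$ in which distinct $u,v$ are adjacent iff there is a vertex $w\notin\{u,v\}$ with either $d_{D-v}(u,w)\le 1$ and $d_{D-u}(v,w)\le 2$, or $d_{D-u}(v,w)\le 1$ and $d_{D-v}(u,w)\le 2$. A multipartite tournament is an orientation of a complete $k$-partite graph for some $k\ge3$ (with nonempty partite sets). A set of vertices is $\{1,2\}$-competing if it is a clique in $C_{1,2}(D)$. A multipartite tournament is loose if some partite set is not $\{1,2\}$-competing. A graph is an interval graph if its vertices can be assigned real intervals so that two distinct vertices are adjacent iff their intervals intersect. -}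

module Defs where

open import Data.Nat using (ℕ; zero; suc; _≥_)
open import Data.Fin using (Fin)
open import Data.Product using (Σ; ∃; _×_; _,_)
open import Data.Sum using (_⊎_)
open import Data.Empty using (⊥)
open import Relation.Nullary using (¬_)
open import Relation.Binary.PropositionalEquality using (_≡_; _≢_)
open import Data.Rational as ℚ using (ℚ)
open import Function.Bundles using (_⇔_)

record Digraph (n : ℕ) : Set₁ where
  field
    Arc      : Fin n → Fin n → Set
    loopless : ∀ x → ¬ Arc x x
open Digraph public

-- Walk of length ≤ k from u to w in D - z, all vertices (including u) ≠ z.
data WalkAvoid {n : ℕ} (D : Digraph n) (z : Fin n) : ℕ → Fin n → Fin n → Set where
  stop : ∀ {k u} → u ≢ z → WalkAvoid D z k u u
  step : ∀ {k u x w} → u ≢ z → Arc D u x → WalkAvoid D z k x w → WalkAvoid D z (suc k) u w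

DistLE : ∀ {n} → Digraph n → (z u w : Fin n) → ℕ → Set
DistLE D z u w k = u ≢ z × w ≢ z × WalkAvoid D z k u w

C12Adj : ∀ {n} → Digraph n → Fin n → Fin n → Set
C12Adj D u v =
  u ≢ v × (∃ λ w → w ≢ u × w ≢ v ×
    ((DistLE D v u w 1 × DistLE D u v w 2) ⊎ (DistLE D u v w 1 × DistLE D v u w 2)))

record MultipartiteTournament {n : ℕ} (D : Digraph n) : Set₁ where
  field
    k         : ℕ
    k≥3       : k ≥ 3
    part      : Fin n → Fin k
    nonempty  : ∀ i → ∃ λ v → part v ≡ i
    samePart  : ∀ u v → part u ≡ part v → ¬ Arc D u v
    diffPart  : ∀ u v → part u ≢ part v → Arc D u v ⊎ Arc D v u
    antisym   : ∀ u v → ¬ (Arc D u v × Arc D v u)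
open MultipartiteTournament public

Competing12 : ∀ {n} → Digraph n → (Fin n → Set) → Set
Competing12 D S = ∀ u v → S u → S v → u ≢ v → C12Adj D u v

Loose : ∀ {n} {D : Digraph n} → MultipartiteTournament D → Set
Loose {D = D} M = ∃ λ i → ¬ Competing12 D (λ v → part M v ≡ i)

PartsAtMostTwo : ∀ {n} {D : Digraph n} → MultipartiteTournament D → Set
PartsAtMostTwo {n} M =
  ∀ (a b c : Fin n) → part M a ≡ part M b → part M b ≡ part M c →
    a ≡ b ⊎ b ≡ c ⊎ a ≡ c

IsIntervalGraph : ∀ {n} → (Fin n → Fin n → Set) → Set
IsIntervalGraph {n} Adj =
  Σ (Fin n → ℚ) λ l → Σ (Fin n → ℚ) λ r →
    (∀ v → l v ℚ.≤ r v) ×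
    (∀ u v → u ≢ v → (Adj u v ⇔ (l u ℚ.≤ r v × l v ℚ.≤ r u)))

{-# OPTIONS --safe #-}
-- Let x, y be the two vertices of a partite set that is not {1,2}-competing. Sinks of D
-- are isolated in C_{1,2}(D), and every vertex outside {x, y} lies in another part, so it
-- is joined to both x and y by an arc. If x is a sink, every non-sink other than y points
-- to x, so all non-isolated vertices are pairwise adjacent, except possibly y and an
-- out-neighbour b of y. If x → a and y → b, non-competition of x and y forces N⁺(x) = {a},
-- N⁺(y) = {b}, a → y and b → x, and every other vertex points to both x and y; then every
-- vertex other than x, b, a, y is adjacent to all non-isolated vertices, while among x, b,
-- a, y only consecutive ones can be adjacent. In every case C_{1,2}(D) consists of
-- isolated vertices, a subgraph of a path, and vertices adjacent to all non-isolated
-- vertices; such a graph is an interval graph: the path vertices get short intervals in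
-- consecutive slots, reaching half-way towards a neighbour, the universal vertices one
-- interval covering all slots, and the isolated vertices points further right.
module Submission where

open import Defs
import Data.Nat as ℕ
open import Data.Nat using (ℕ; zero; suc; _+_; _*_; _≤_; _<_; z≤n; s≤s)
open import Data.Nat.Properties
  using (≤-refl; ≤-trans; <⇒≱; <⇒≢; <-cmp; n≤1+n; m≤n⇒m≤1+n; 1+n≰n; m≤m+n; m≤n⇒m<n∨m≡n;
         *-monoˡ-≤; +-cancelˡ-≡; suc-injective)
import Data.Nat.Coprimality as Coprimality
open import Data.Integer as ℤ using (+_; +≤+)
open import Data.Integer.Properties using (*-identityʳ; drop‿+≤+)
open import Data.Rational as ℚ using (ℚ; mkℚ; *≤*)
open import Data.Fin using (Fin; zero; suc; toℕ; _≟_)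
open import Data.Fin.Properties using (any?; toℕ-injective; toℕ<n)
open import Data.Vec.Functional using ([]; _∷_)
open import Data.Product using (∃; ∃₂; _×_; _,_; proj₂; swap)
import Data.Product as Product
open import Data.Sum using (_⊎_; inj₁; inj₂)
open import Function using (_∘_)
open import Function.Bundles using (_⇔_; mk⇔; Equivalence)
open import Relation.Nullary using (¬_; Dec; yes; no; contradiction)
open import Relation.Nullary.Decidable using (_×-dec_; _⊎-dec_; ¬?)
import Relation.Nullary.Decidable as Dec
open import Relation.Binary.Definitions using (Symmetric; Decidable; tri<; tri≈; tri>)
open import Relation.Binary.PropositionalEquality
  using (_≡_; _≢_; refl; sym; trans; cong; subst; subst₂; ≢-sym)

open Equivalence using (to; from)

private
  variable
    n : ℕ

record NatIntervalModel (Adj : Fin n → Fin n → Set) : Set where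
  field
    left right  : Fin n → ℕ
    left≤right  : ∀ v → left v ≤ right v
    adj⇔overlap : ∀ {u v} → u ≢ v → Adj u v ⇔ (left u ≤ right v × left v ≤ right u)

fromℕ : ℕ → ℚ
fromℕ m = mkℚ (+ m) 0 (Coprimality.sym (Coprimality.1-coprimeTo m))

fromℕ-mono-≤ : ∀ {m k} → m ≤ k → fromℕ m ℚ.≤ fromℕ k
fromℕ-mono-≤ {m} {k} m≤k =
  *≤* (subst₂ ℤ._≤_ (sym (*-identityʳ (+ m))) (sym (*-identityʳ (+ k))) (+≤+ m≤k))

fromℕ-cancel-≤ : ∀ {m k} → fromℕ m ℚ.≤ fromℕ k → m ≤ k
fromℕ-cancel-≤ {m} {k} (*≤* le) = drop‿+≤+ (subst₂ ℤ._≤_ (*-identityʳ (+ m)) (*-identityʳ (+ k)) le)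

natIntervalModel⇒isIntervalGraph : ∀ {Adj : Fin n → Fin n → Set} →
  NatIntervalModel Adj → IsIntervalGraph Adj
natIntervalModel⇒isIntervalGraph model =
  fromℕ ∘ left , fromℕ ∘ right , fromℕ-mono-≤ ∘ left≤right ,
  λ u v u≢v → mk⇔ (Product.map fromℕ-mono-≤ fromℕ-mono-≤ ∘ to (adj⇔overlap u≢v))
                  (from (adj⇔overlap u≢v) ∘ Product.map fromℕ-cancel-≤ fromℕ-cancel-≤)
  where open NatIntervalModel model

sym-⇔-swap : ∀ {Adj : Fin n → Fin n → Set} {A B : Set} → Symmetric Adj →
  ∀ {u v} → Adj v u ⇔ (A × B) → Adj u v ⇔ (B × A)
sym-⇔-swap adj-sym vu = mk⇔ (swap ∘ to vu ∘ adj-sym) (adj-sym ∘ from vu ∘ swap)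

lower upper : ∀ {A : Set} → Dec A → ℕ → ℕ
lower (yes _) m = m
lower (no _)  m = suc m
upper (yes _) m = suc (suc m)
upper (no _)  m = suc m

lower≤1+ : ∀ {A : Set} (d : Dec A) m → lower d m ≤ suc m
lower≤1+ (yes _) m = n≤1+n m
lower≤1+ (no _)  m = ≤-refl

≤lower : ∀ {A : Set} (d : Dec A) m → m ≤ lower d m
≤lower (yes _) m = ≤-refl
≤lower (no _)  m = n≤1+n m

1+≤upper : ∀ {A : Set} (d : Dec A) m → suc m ≤ upper d m
1+≤upper (yes _) m = n≤1+n (suc m)
1+≤upper (no _)  m = ≤-refl

upper≤2+ : ∀ {A : Set} (d : Dec A) m → upper d m ≤ suc (suc m)
upper≤2+ (yes _) m = ≤-refl
upper≤2+ (no _)  m = n≤1+n (suc m)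

lower[2+]≤upper⇔ : ∀ {A B : Set} (d : Dec A) (e : Dec B) m → lower d (suc (suc m)) ≤ upper e m ⇔ (A × B)
lower[2+]≤upper⇔ (yes a) (yes b) m = mk⇔ (λ _ → a , b) (λ _ → ≤-refl)
lower[2+]≤upper⇔ (yes _) (no ¬b) m = mk⇔ (λ le → contradiction le 1+n≰n) (λ (_ , b) → contradiction b ¬b)
lower[2+]≤upper⇔ (no ¬a) e m =
  mk⇔ (λ le → contradiction (≤-trans le (upper≤2+ e m)) 1+n≰n) (λ (a , _) → contradiction a ¬a)

-- A vertex at position p gets an interval inside [2p, 2p+2] containing 2p+1, reaching 2p
-- (resp. 2p+2) exactly when it is adjacent to the vertex at position p-1 (resp. p+1).
module LinearForest
  {Adj : Fin n → Fin n → Set} (adj? : Decidable Adj) (adj-sym : Symmetric Adj)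
  {P : Fin n → Set} (P? : ∀ v → Dec (P v)) (pos : Fin n → ℕ)
  (pos-injective : ∀ {u v} → P u → P v → pos u ≡ pos v → u ≡ v)
  (gap⇒¬adj : ∀ {u v} → P u → P v → suc (pos u) < pos v → ¬ Adj u v)
  where

  JoinedAbove JoinedBelow : Fin n → Set
  JoinedAbove u = ∃ λ w → P w × pos w ≡ suc (pos u) × Adj u w
  JoinedBelow v = ∃ λ w → P w × pos v ≡ suc (pos w) × Adj w v

  joinedAbove? : ∀ u → Dec (JoinedAbove u)
  joinedAbove? u = any? λ w → P? w ×-dec pos w ℕ.≟ suc (pos u) ×-dec adj? u w

  joinedBelow? : ∀ v → Dec (JoinedBelow v)
  joinedBelow? v = any? λ w → P? w ×-dec pos v ℕ.≟ suc (pos w) ×-dec adj? w v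

  left right : Fin n → ℕ
  left v  = lower (joinedBelow? v) (pos v * 2)
  right v = upper (joinedAbove? v) (pos v * 2)

  2pos≤left : ∀ v → pos v * 2 ≤ left v
  2pos≤left v = ≤lower (joinedBelow? v) (pos v * 2)

  left≤1+2pos : ∀ v → left v ≤ suc (pos v * 2)
  left≤1+2pos v = lower≤1+ (joinedBelow? v) (pos v * 2)

  1+2pos≤right : ∀ v → suc (pos v * 2) ≤ right v
  1+2pos≤right v = 1+≤upper (joinedAbove? v) (pos v * 2)

  right≤2+2pos : ∀ v → right v ≤ suc (suc (pos v * 2))
  right≤2+2pos v = upper≤2+ (joinedAbove? v) (pos v * 2)

  left≤right : ∀ v → left v ≤ right v
  left≤right v = ≤-trans (left≤1+2pos v) (1+2pos≤right v)

  module _ {u v} (pu : P u) (pv : P v) (next : pos v ≡ suc (pos u)) where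

    joinedAbove⇒adj : JoinedAbove u → Adj u v
    joinedAbove⇒adj (w , pw , w-next , uw) =
      subst (Adj u) (pos-injective pw pv (trans w-next (sym next))) uw

    left≤right⇔joined : left v ≤ right u ⇔ (JoinedBelow v × JoinedAbove u)
    left≤right⇔joined =
      subst (λ p → lower (joinedBelow? v) (p * 2) ≤ right u ⇔ (JoinedBelow v × JoinedAbove u)) (sym next)
            (lower[2+]≤upper⇔ (joinedBelow? v) (joinedAbove? u) (pos u * 2))

    left≤right-next : left u ≤ right v
    left≤right-next =
      ≤-trans (left≤1+2pos u)
        (≤-trans (m≤n⇒m≤1+n (n≤1+n _)) (subst (λ p → suc (p * 2) ≤ right v) next (1+2pos≤right v)))

    adj⇔overlap-next : Adj u v ⇔ (left u ≤ right v × left v ≤ right u)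
    adj⇔overlap-next = mk⇔
      (λ uv → left≤right-next , from left≤right⇔joined ((u , pu , next , uv) , (v , pv , next , uv)))
      (joinedAbove⇒adj ∘ proj₂ ∘ to left≤right⇔joined ∘ proj₂)

  right<left-far : ∀ {u v} → suc (pos u) < pos v → right u < left v
  right<left-far {u} {v} far =
    ≤-trans (s≤s (right≤2+2pos u)) (≤-trans (n≤1+n _) (≤-trans (*-monoˡ-≤ 2 far) (2pos≤left v)))

  adj⇔overlap-< : ∀ {u v} → P u → P v → pos u < pos v → Adj u v ⇔ (left u ≤ right v × left v ≤ right u)
  adj⇔overlap-< pu pv u<v with m≤n⇒m<n∨m≡n u<v
  ... | inj₁ far  = mk⇔ (λ uv → contradiction uv (gap⇒¬adj pu pv far))
                        (λ (_ , le) → contradiction le (<⇒≱ (right<left-far far)))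
  ... | inj₂ next = adj⇔overlap-next pu pv (sym next)

  adj⇔overlap : ∀ {u v} → P u → P v → u ≢ v → Adj u v ⇔ (left u ≤ right v × left v ≤ right u)
  adj⇔overlap {u} {v} pu pv u≢v with <-cmp (pos u) (pos v)
  ... | tri< u<v _ _ = adj⇔overlap-< pu pv u<v
  ... | tri≈ _ same _ = contradiction (pos-injective pu pv same) u≢v
  ... | tri> _ _ v<u = sym-⇔-swap {Adj = Adj} adj-sym (adj⇔overlap-< pv pu v<u)

OnPath : ∀ {m} → (Fin m → Fin n) → Fin n → Set
OnPath path v = ∃ λ i → path i ≡ v

-- Path vertices sit at their index; isolated vertices are added to the forest at the
-- pairwise distinct positions m + 1 + v, so their intervals lie beyond the interval [0, 2m]
-- shared by all universal vertices.
module PathWithUniversalVertices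
  {Adj : Fin n → Fin n → Set} (adj? : Decidable Adj) (adj-sym : Symmetric Adj)
  {Isolated : Fin n → Set} (isolated? : ∀ v → Dec (Isolated v))
  (isolated⇒¬adj : ∀ {u v} → Isolated u → ¬ Adj u v)
  {m : ℕ} (path : Fin m → Fin n)
  (gap⇒¬adj : ∀ {i j} → suc (toℕ i) < toℕ j → ¬ Adj (path i) (path j))
  (universal : ∀ {u v} → u ≢ v → ¬ Isolated u → ¬ Isolated v → ¬ OnPath path u → Adj u v)
  where

  onPath? : ∀ v → Dec (OnPath path v)
  onPath? v = any? λ i → path i ≟ v

  Placed : Fin n → Set
  Placed v = Isolated v ⊎ OnPath path v

  placed? : ∀ v → Dec (Placed v)
  placed? v = isolated? v ⊎-dec onPath? v

  rank : ∀ v → Dec (Isolated v) → Dec (OnPath path v) → ℕ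
  rank v (yes _) _            = suc (m + toℕ v)
  rank v (no _)  (yes (i , _)) = toℕ i
  rank v (no _)  (no _)        = 0

  pos : Fin n → ℕ
  pos v = rank v (isolated? v) (onPath? v)

  pos-isolated : ∀ {v} → Isolated v → pos v ≡ suc (m + toℕ v)
  pos-isolated {v} iso = go (isolated? v) (onPath? v)
    where
    go : ∀ d e → rank v d e ≡ suc (m + toℕ v)
    go (yes _)   _ = refl
    go (no ¬iso) _ = contradiction iso ¬iso

  placed⇒onPath : ∀ {v} → ¬ Isolated v → Placed v → OnPath path v
  placed⇒onPath ¬iso (inj₁ iso)    = contradiction iso ¬iso
  placed⇒onPath ¬iso (inj₂ onPath) = onPath

  pos-onPath : ∀ {v} → ¬ Isolated v → Placed v → ∃ λ i → path i ≡ v × pos v ≡ toℕ i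
  pos-onPath {v} ¬iso placed = go (isolated? v) (onPath? v)
    where
    go : ∀ d e → ∃ λ i → path i ≡ v × rank v d e ≡ toℕ i
    go (yes iso) _             = contradiction iso ¬iso
    go (no _)    (yes (i , e)) = i , e , refl
    go (no _)    (no ¬onPath)  = contradiction (placed⇒onPath ¬iso placed) ¬onPath

  path<isolated : ∀ (i : Fin m) (v : Fin n) → toℕ i < suc (m + toℕ v)
  path<isolated i v = m≤n⇒m≤1+n (≤-trans (toℕ<n i) (m≤m+n m (toℕ v)))

  pos-injective : ∀ {u v} → Placed u → Placed v → pos u ≡ pos v → u ≡ v
  pos-injective {u} {v} pu pv same = go (isolated? u) (isolated? v)
    where
    go : Dec (Isolated u) → Dec (Isolated v) → u ≡ v
    go (yes iu) (yes iv) = toℕ-injective (+-cancelˡ-≡ m _ _ (suc-injective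
      (trans (sym (pos-isolated iu)) (trans same (pos-isolated iv)))))
    go (yes iu) (no ¬iv) =
      let (j , _ , pos-v) = pos-onPath ¬iv pv
      in contradiction (trans (sym (pos-isolated iu)) (trans same pos-v))
                       (≢-sym (<⇒≢ (path<isolated j u)))
    go (no ¬iu) (yes iv) =
      let (i , _ , pos-u) = pos-onPath ¬iu pu
      in contradiction (trans (sym pos-u) (trans same (pos-isolated iv))) (<⇒≢ (path<isolated i v))
    go (no ¬iu) (no ¬iv) =
      let (i , path-i , pos-u) = pos-onPath ¬iu pu
          (j , path-j , pos-v) = pos-onPath ¬iv pv
      in subst₂ _≡_ path-i path-j (cong path (toℕ-injective (trans (sym pos-u) (trans same pos-v))))

  gap⇒¬adj′ : ∀ {u v} → Placed u → Placed v → suc (pos u) < pos v → ¬ Adj u v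
  gap⇒¬adj′ {u} {v} pu pv far = go (isolated? u) (isolated? v)
    where
    go : Dec (Isolated u) → Dec (Isolated v) → ¬ Adj u v
    go (yes iu) _        = isolated⇒¬adj iu
    go (no _)   (yes iv) = isolated⇒¬adj iv ∘ adj-sym
    go (no ¬iu) (no ¬iv) =
      let (i , path-i , pos-u) = pos-onPath ¬iu pu
          (j , path-j , pos-v) = pos-onPath ¬iv pv
      in subst₂ (λ s t → ¬ Adj s t) path-i path-j (gap⇒¬adj (subst₂ (λ p q → suc p < q) pos-u pos-v far))

  module Forest = LinearForest adj? adj-sym placed? pos pos-injective gap⇒¬adj′

  leftBy rightBy : ∀ v → Dec (Placed v) → ℕ
  leftBy v (yes _)  = Forest.left v
  leftBy v (no _)   = 0
  rightBy v (yes _) = Forest.right v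
  rightBy v (no _)  = m * 2

  left≤rightBy : ∀ v d → leftBy v d ≤ rightBy v d
  left≤rightBy v (yes _) = Forest.left≤right v
  left≤rightBy v (no _)  = z≤n

  universal⇔overlap : ∀ {u v} → u ≢ v → ¬ Placed u → Placed v →
    Adj u v ⇔ (0 ≤ Forest.right v × Forest.left v ≤ m * 2)
  universal⇔overlap {u} {v} u≢v ¬pu pv = go (isolated? v)
    where
    go : Dec (Isolated v) → Adj u v ⇔ (0 ≤ Forest.right v × Forest.left v ≤ m * 2)
    go (yes iv) = mk⇔ (λ uv → contradiction (adj-sym uv) (isolated⇒¬adj iv))
                      (λ (_ , le) → contradiction le (<⇒≱ isolated-beyond))
      where
      isolated-beyond : m * 2 < Forest.left v
      isolated-beyond = ≤-trans (s≤s (n≤1+n (m * 2)))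
        (≤-trans (*-monoˡ-≤ 2 (m≤m+n (suc m) (toℕ v)))
          (subst (λ p → p * 2 ≤ Forest.left v) (pos-isolated iv) (Forest.2pos≤left v)))
    go (no ¬iv) = mk⇔ (λ _ → z≤n , path-inside)
                      (λ _ → universal u≢v (¬pu ∘ inj₁) ¬iv (¬pu ∘ inj₂))
      where
      path-inside : Forest.left v ≤ m * 2
      path-inside =
        let (i , _ , pos-v) = pos-onPath ¬iv pv
        in ≤-trans (Forest.left≤right v) (≤-trans (Forest.right≤2+2pos v)
             (subst (λ p → suc (suc (p * 2)) ≤ m * 2) (sym pos-v) (*-monoˡ-≤ 2 (toℕ<n i))))

  adj⇔overlapBy : ∀ {u v} → u ≢ v → ∀ du dv →
    Adj u v ⇔ (leftBy u du ≤ rightBy v dv × leftBy v dv ≤ rightBy u du)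
  adj⇔overlapBy u≢v (yes pu) (yes pv) = Forest.adj⇔overlap pu pv u≢v
  adj⇔overlapBy u≢v (no ¬pu) (yes pv) = universal⇔overlap u≢v ¬pu pv
  adj⇔overlapBy u≢v (yes pu) (no ¬pv) =
    sym-⇔-swap {Adj = Adj} adj-sym (universal⇔overlap (≢-sym u≢v) ¬pv pu)
  adj⇔overlapBy u≢v (no ¬pu) (no ¬pv) =
    mk⇔ (λ _ → z≤n , z≤n) (λ _ → universal u≢v (¬pu ∘ inj₁) (¬pv ∘ inj₁) (¬pu ∘ inj₂))

  intervalModel : NatIntervalModel Adj
  intervalModel = record
    { left        = λ v → leftBy v (placed? v)
    ; right       = λ v → rightBy v (placed? v)
    ; left≤right  = λ v → left≤rightBy v (placed? v)
    ; adj⇔overlap = λ {u} {v} u≢v → adj⇔overlapBy u≢v (placed? u) (placed? v)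
    }

OneTwoPrey : Digraph n → (u v w : Fin n) → Set
OneTwoPrey D u v w = Arc D u w × (Arc D v w ⊎ ∃ λ z → z ≢ u × Arc D v z × Arc D z w)

Sink : Digraph n → Fin n → Set
Sink D u = ¬ ∃ λ w → Arc D u w

arc⇒≢ : (D : Digraph n) → ∀ {u w} → Arc D u w → w ≢ u
arc⇒≢ D {u} uw refl = loopless D u uw

module _ {D : Digraph n} where

  distLE1⇒arc : ∀ {z u w} → DistLE D z u w 1 → w ≢ u → Arc D u w
  distLE1⇒arc (_ , _ , stop _)             w≢u = contradiction refl w≢u
  distLE1⇒arc (_ , _ , step _ uw (stop _)) _   = uw

  distLE2⇒twoStep : ∀ {z u w} → DistLE D z u w 2 → w ≢ u →
    Arc D u w ⊎ ∃ λ x → x ≢ z × Arc D u x × Arc D x w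
  distLE2⇒twoStep (_ , _ , stop _)                           w≢u = contradiction refl w≢u
  distLE2⇒twoStep (_ , _ , step _ uw (stop _))               _   = inj₁ uw
  distLE2⇒twoStep (_ , _ , step _ ux (step x≢z xw (stop _))) _   = inj₂ (_ , x≢z , ux , xw)

  prey⇒distLE : ∀ {u v w} → u ≢ v → w ≢ u → w ≢ v → OneTwoPrey D u v w →
    DistLE D v u w 1 × DistLE D u v w 2
  prey⇒distLE u≢v w≢u w≢v (uw , inj₁ vw) =
    (u≢v , w≢v , step u≢v uw (stop w≢v)) , (≢-sym u≢v , w≢u , step (≢-sym u≢v) vw (stop w≢u))
  prey⇒distLE u≢v w≢u w≢v (uw , inj₂ (_ , z≢u , vz , zw)) =
    (u≢v , w≢v , step u≢v uw (stop w≢v)) ,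
    (≢-sym u≢v , w≢u , step (≢-sym u≢v) vz (step z≢u zw (stop w≢u)))

  c12⇔prey : ∀ {u v} → C12Adj D u v ⇔
    (u ≢ v × ∃ λ w → w ≢ u × w ≢ v × (OneTwoPrey D u v w ⊎ OneTwoPrey D v u w))
  c12⇔prey = mk⇔
    (λ { (u≢v , w , w≢u , w≢v , inj₁ (d₁ , d₂)) →
           u≢v , w , w≢u , w≢v , inj₁ (distLE1⇒arc d₁ w≢u , distLE2⇒twoStep d₂ w≢v)
       ; (u≢v , w , w≢u , w≢v , inj₂ (d₁ , d₂)) →
           u≢v , w , w≢u , w≢v , inj₂ (distLE1⇒arc d₁ w≢v , distLE2⇒twoStep d₂ w≢u) })
    (λ { (u≢v , w , w≢u , w≢v , inj₁ prey) →
           u≢v , w , w≢u , w≢v , inj₁ (prey⇒distLE u≢v w≢u w≢v prey)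
       ; (u≢v , w , w≢u , w≢v , inj₂ prey) →
           u≢v , w , w≢u , w≢v , inj₂ (prey⇒distLE (≢-sym u≢v) w≢v w≢u prey) })

  c12-sym : Symmetric (C12Adj D)
  c12-sym (u≢v , w , w≢u , w≢v , inj₁ d) = ≢-sym u≢v , w , w≢v , w≢u , inj₂ d
  c12-sym (u≢v , w , w≢u , w≢v , inj₂ d) = ≢-sym u≢v , w , w≢v , w≢u , inj₁ d

  twoStep⇒c12 : ∀ {u v w z} → u ≢ v → w ≢ v → z ≢ u → Arc D u w → Arc D v z → Arc D z w → C12Adj D u v
  twoStep⇒c12 u≢v w≢v z≢u uw vz zw =
    from c12⇔prey (u≢v , _ , arc⇒≢ D uw , w≢v , inj₁ (uw , inj₂ (_ , z≢u , vz , zw)))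

  commonOut⇒c12 : ∀ {u v w} → u ≢ v → Arc D u w → Arc D v w → C12Adj D u v
  commonOut⇒c12 u≢v uw vw = from c12⇔prey (u≢v , _ , arc⇒≢ D uw , arc⇒≢ D vw , inj₁ (uw , inj₁ vw))

  soleOut⇒¬c12 : ∀ {u v} → (∀ w → Arc D u w → w ≡ v) → ¬ C12Adj D u v
  soleOut⇒¬c12 sole adj with to c12⇔prey adj
  ... | _ , w , _ , w≢v , inj₁ (uw , _)                      = w≢v (sole w uw)
  ... | _ , w , _ , w≢v , inj₂ (_ , inj₁ uw)                 = w≢v (sole w uw)
  ... | _ , _ , _ , _   , inj₂ (_ , inj₂ (z , z≢v , uz , _)) = z≢v (sole z uz)

  sink⇒¬c12 : ∀ {u v} → Sink D u → ¬ C12Adj D u v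
  sink⇒¬c12 sink = soleOut⇒¬c12 λ w uw → contradiction (w , uw) sink

module _ {D : Digraph n} (M : MultipartiteTournament D) where

  arc? : Decidable (Arc D)
  arc? u v with part M u ≟ part M v
  ... | yes same = no (samePart M u v same)
  ... | no diff with diffPart M u v diff
  ...   | inj₁ uv = yes uv
  ...   | inj₂ vu = no λ uv → antisym M u v (uv , vu)

  c12? : Decidable (C12Adj D)
  c12? u v = Dec.map′ (from c12⇔prey) (to c12⇔prey)
    (¬? (u ≟ v) ×-dec any? λ w → ¬? (w ≟ u) ×-dec ¬? (w ≟ v) ×-dec (prey? u v w ⊎-dec prey? v u w))
    where
    prey? : ∀ u v w → Dec (OneTwoPrey D u v w)
    prey? u v w = arc? u w ×-dec (arc? v w ⊎-dec any? λ z → ¬? (z ≟ u) ×-dec arc? v z ×-dec arc? z w)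

  sink? : ∀ u → Dec (Sink D u)
  sink? u = ¬? (any? (arc? u))

  nonCompetingPair : Loose M → ∃₂ λ x y → x ≢ y × part M x ≡ part M y × ¬ C12Adj D x y
  nonCompetingPair (i , ¬competing) with any? (λ x → any? λ y →
      ¬? (x ≟ y) ×-dec part M x ≟ part M y ×-dec part M x ≟ i ×-dec ¬? (c12? x y))
  ... | yes (x , y , x≢y , same , _ , ¬xy) = x , y , x≢y , same , ¬xy
  ... | no none = contradiction competing ¬competing
    where
    competing : Competing12 D (λ v → part M v ≡ i)
    competing x y x∈i y∈i x≢y with c12? x y
    ... | yes xy = xy
    ... | no ¬xy = contradiction (x , y , x≢y , trans x∈i (sym y∈i) , x∈i , ¬xy) none

  outsidePart : PartsAtMostTwo M → ∀ {x y v} → x ≢ y → part M x ≡ part M y →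
    v ≢ x → v ≢ y → part M v ≢ part M x
  outsidePart atMostTwo {x} {y} {v} x≢y same v≢x v≢y v∼x
    with atMostTwo x y v same (trans (sym same) (sym v∼x))
  ... | inj₁ x≡y        = x≢y x≡y
  ... | inj₂ (inj₁ y≡v) = v≢y (sym y≡v)
  ... | inj₂ (inj₂ x≡v) = v≢x (sym x≡v)

  arcInto : PartsAtMostTwo M → ∀ {x y v} → x ≢ y → part M x ≡ part M y →
    v ≢ x → v ≢ y → ¬ Arc D x v → Arc D v x
  arcInto atMostTwo {x} {y} {v} x≢y same v≢x v≢y ¬xv
    with diffPart M v x (outsidePart atMostTwo x≢y same v≢x v≢y)
  ... | inj₁ vx = vx
  ... | inj₂ xv = contradiction xv ¬xv

  arc⇒≢samePart : ∀ {u v w} → part M u ≡ part M v → Arc D u w → w ≢ v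
  arc⇒≢samePart same uw refl = samePart M _ _ same uw

module NonCompetingPair
  {D : Digraph n} (M : MultipartiteTournament D) (atMostTwo : PartsAtMostTwo M)
  {x y : Fin n} (x≢y : x ≢ y) (same : part M x ≡ part M y) (¬xy : ¬ C12Adj D x y)
  where

  module Model {m} (path : Fin m → Fin n) =
    PathWithUniversalVertices (c12? M) c12-sym (sink? M) sink⇒¬c12 path

  offPath : ∀ {m} {path : Fin m → Fin n} {u} → ¬ OnPath path u → ∀ i → u ≢ path i
  offPath u∉path i u≡i = u∉path (i , sym u≡i)

  nonSink≢ : ∀ {u v} → Sink D v → ¬ Sink D u → u ≢ v
  nonSink≢ sink-v ¬sink-u refl = ¬sink-u sink-v

  intoSink : Sink D x → ∀ {u} → u ≢ x → u ≢ y → Arc D u x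
  intoSink sink-x u≢x u≢y = arcInto M atMostTwo x≢y same u≢x u≢y (sink-x ∘ (_ ,_))

  nonSinkIntoSink : Sink D x → ∀ {u} → ¬ Sink D u → u ≢ y → Arc D u x
  nonSinkIntoSink sink-x ¬sink = intoSink sink-x (nonSink≢ sink-x ¬sink)

  bothSinks : Sink D x → Sink D y → NatIntervalModel (C12Adj D)
  bothSinks sink-x sink-y = Model.intervalModel noPath gap universal
    where
    noPath : Fin 0 → Fin n
    noPath ()

    gap : ∀ {i j : Fin 0} → suc (toℕ i) < toℕ j → ¬ C12Adj D (noPath i) (noPath j)
    gap {()}

    into : ∀ {u} → ¬ Sink D u → Arc D u x
    into ¬sink = nonSinkIntoSink sink-x ¬sink (nonSink≢ sink-y ¬sink)

    universal : ∀ {u v} → u ≢ v → ¬ Sink D u → ¬ Sink D v → ¬ OnPath noPath u → C12Adj D u v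
    universal u≢v ¬sink-u ¬sink-v _ = commonOut⇒c12 u≢v (into ¬sink-u) (into ¬sink-v)

  sinkAndSource : Sink D x → ∀ {b} → Arc D y b → NatIntervalModel (C12Adj D)
  sinkAndSource sink-x {b} yb = Model.intervalModel path gap universal
    where
    path : Fin 2 → Fin n
    path = y ∷ b ∷ []

    gap : ∀ {i j : Fin 2} → suc (toℕ i) < toℕ j → ¬ C12Adj D (path i) (path j)
    gap {j = zero}     ()
    gap {j = suc zero} (s≤s ())

    bx : Arc D b x
    bx = intoSink sink-x (arc⇒≢samePart M (sym same) yb) (arc⇒≢ D yb)

    universal : ∀ {u v} → u ≢ v → ¬ Sink D u → ¬ Sink D v → ¬ OnPath path u → C12Adj D u v
    universal {u} {v} u≢v ¬sink-u ¬sink-v u∉path with v ≟ y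
    ... | yes refl = twoStep⇒c12 u≢v x≢y (≢-sym (offPath u∉path (suc zero)))
                       (nonSinkIntoSink sink-x ¬sink-u (offPath u∉path zero)) yb bx
    ... | no v≢y   = commonOut⇒c12 u≢v (nonSinkIntoSink sink-x ¬sink-u (offPath u∉path zero))
                       (nonSinkIntoSink sink-x ¬sink-v v≢y)

  module BothSources {a b} (xa : Arc D x a) (yb : Arc D y b) where

    noCommonOut : ∀ {w} → Arc D x w → ¬ Arc D y w
    noCommonOut xw yw = ¬xy (commonOut⇒c12 x≢y xw yw)

    -- an arc between an out-neighbour of x and one of y would make x and y compete
    outsSamePart : ∀ {w w′} → Arc D x w → Arc D y w′ → part M w ≡ part M w′
    outsSamePart {w} {w′} xw yw′ with part M w ≟ part M w′
    ... | yes w∼w′ = w∼w′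
    ... | no w≁w′ with diffPart M w w′ w≁w′
    ...   | inj₁ ww′ = contradiction (c12-sym (twoStep⇒c12 (≢-sym x≢y) (arc⇒≢samePart M (sym same) yw′)
                                                 (arc⇒≢samePart M same xw) yw′ xw ww′)) ¬xy
    ...   | inj₂ w′w = contradiction (twoStep⇒c12 x≢y (arc⇒≢samePart M same xw)
                                        (arc⇒≢samePart M (sym same) yw′) xw yw′ w′w) ¬xy

    a∼b : part M a ≡ part M b
    a∼b = outsSamePart xa yb

    a≢b : a ≢ b
    a≢b refl = noCommonOut xa yb

    outX≡a : ∀ w → Arc D x w → w ≡ a
    outX≡a w xw with atMostTwo w a b (trans (outsSamePart xw yb) (sym a∼b)) a∼b
    ... | inj₁ w≡a        = w≡a
    ... | inj₂ (inj₁ a≡b) = contradiction a≡b a≢b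
    ... | inj₂ (inj₂ refl) = contradiction yb (noCommonOut xw)

    outY≡b : ∀ w → Arc D y w → w ≡ b
    outY≡b w yw with atMostTwo a b w a∼b (trans (sym a∼b) (outsSamePart xa yw))
    ... | inj₁ a≡b        = contradiction a≡b a≢b
    ... | inj₂ (inj₁ b≡w) = sym b≡w
    ... | inj₂ (inj₂ refl) = contradiction yw (noCommonOut xa)

    intoX : ∀ {v} → v ≢ x → v ≢ y → v ≢ a → Arc D v x
    intoX v≢x v≢y v≢a = arcInto M atMostTwo x≢y same v≢x v≢y (v≢a ∘ outX≡a _)

    intoY : ∀ {v} → v ≢ x → v ≢ y → v ≢ b → Arc D v y
    intoY v≢x v≢y v≢b = arcInto M atMostTwo (≢-sym x≢y) (sym same) v≢y v≢x (v≢b ∘ outY≡b _)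

    ay : Arc D a y
    ay = intoY (arc⇒≢ D xa) (arc⇒≢samePart M same xa) a≢b

    bx : Arc D b x
    bx = intoX (arc⇒≢samePart M (sym same) yb) (arc⇒≢ D yb) (≢-sym a≢b)

    path : Fin 4 → Fin n
    path = x ∷ b ∷ a ∷ y ∷ []

    gap : ∀ {i j : Fin 4} → suc (toℕ i) < toℕ j → ¬ C12Adj D (path i) (path j)
    gap {zero}     {suc (suc zero)}       _ = soleOut⇒¬c12 outX≡a
    gap {zero}     {suc (suc (suc zero))} _ = ¬xy
    gap {suc zero} {suc (suc (suc zero))} _ = soleOut⇒¬c12 outY≡b ∘ c12-sym
    gap {_}        {zero}                 ()
    gap {_}        {suc zero}             (s≤s ())
    gap {suc _}    {suc (suc zero)}       (s≤s (s≤s ()))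
    gap {suc (suc _)} {suc (suc (suc zero))} (s≤s (s≤s (s≤s ())))

    outsider→x : ∀ {u} → ¬ OnPath path u → Arc D u x
    outsider→x u∉path = intoX (offPath u∉path zero) (offPath u∉path (suc (suc (suc zero))))
                              (offPath u∉path (suc (suc zero)))

    outsider→y : ∀ {u} → ¬ OnPath path u → Arc D u y
    outsider→y u∉path = intoY (offPath u∉path zero) (offPath u∉path (suc (suc (suc zero))))
                              (offPath u∉path (suc zero))

    universal : ∀ {u v} → u ≢ v → ¬ Sink D u → ¬ Sink D v → ¬ OnPath path u → C12Adj D u v
    universal {u} {v} u≢v _ _ u∉path with v ≟ x | v ≟ y | v ≟ a
    ... | yes refl | _        | _        =
      twoStep⇒c12 u≢v (≢-sym x≢y) (≢-sym (offPath u∉path (suc (suc zero)))) (outsider→y u∉path) xa ay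
    ... | no _     | yes refl | _        =
      twoStep⇒c12 u≢v x≢y (≢-sym (offPath u∉path (suc zero))) (outsider→x u∉path) yb bx
    ... | no _     | no _     | yes refl = commonOut⇒c12 u≢v (outsider→y u∉path) ay
    ... | no v≢x   | no v≢y   | no v≢a   = commonOut⇒c12 u≢v (outsider→x u∉path) (intoX v≢x v≢y v≢a)

    intervalModel : NatIntervalModel (C12Adj D)
    intervalModel = Model.intervalModel path gap universal

module _ {D : Digraph n} (M : MultipartiteTournament D) (atMostTwo : PartsAtMostTwo M)
  {x y : Fin n} (x≢y : x ≢ y) (same : part M x ≡ part M y) (¬xy : ¬ C12Adj D x y)
  where

  private
    module XY = NonCompetingPair M atMostTwo x≢y same ¬xy
    module YX = NonCompetingPair M atMostTwo (≢-sym x≢y) (sym same) (¬xy ∘ c12-sym)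

  nonCompetingPairModel : NatIntervalModel (C12Adj D)
  nonCompetingPairModel with any? (arc? M x) | any? (arc? M y)
  ... | no ¬xOut     | no ¬yOut     = XY.bothSinks ¬xOut ¬yOut
  ... | no ¬xOut     | yes (_ , yb) = XY.sinkAndSource ¬xOut yb
  ... | yes (_ , xa) | no ¬yOut     = YX.sinkAndSource ¬yOut xa
  ... | yes (_ , xa) | yes (_ , yb) = XY.BothSources.intervalModel xa yb

theorem4p8 : ∀ {n : ℕ} (D : Digraph n) (M : MultipartiteTournament D) →
    Loose M → PartsAtMostTwo M → IsIntervalGraph (C12Adj D)
theorem4p8 D M loose atMostTwo =
  let (x , y , x≢y , same , ¬xy) = nonCompetingPair M loose
  in natIntervalModel⇒isIntervalGraph (nonCompetingPairModel M atMostTwo x≢y same ¬xy)
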